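{- Let $A$ and $B$ be finite sets with at least two elements, let $n \geq 2$, and let $f \colon A^n \to B$ be a function with a unique identification minor, i.e., $f_I \equiv f_J$ for all $2$-element subsets $I, J$ of $\{1, \dots, n\}$. Then $f$ is reconstructible if and only if $f$ is set-reconstructible.
   Context: For a function $f \colon A^n \to B$ ($n \geq 2$) and a $2$-element subset $I = \{i, j\}$ of $\{1,\dots,n\}$ with $i < j$, the identification minor $f_I \colon A^{n-1} \to B$ is defined by $f_I(a_1, \dots, a_{n-1}) = f(a_1, \dots, a_{j-1}, a_i, a_j, \dots, a_{n-1})$. A function $f \colon A^n \to B$ is a minor of $g \colon A^m \to B$ if there is a map $\sigma \colon \{1,\dots,m\} \to \{1,\dots,n\}$ such that $f(a_1,\dots,a_n) = g(a_{\sigma(1)}, \dots, a_{\sigma(m)})$ for all $(a_1,\dots,a_n) \in A^n$; $f$ and $g$ are equivalent, $f \equiv g$, if each is a minor of the other. The deck of $f$ is the multiset of the $\equiv$-classes $f_I/{\equiv}$ over all $2$-element subsets $I$ of $\{1,\dots,n\}$ (counted with multiplicity), and the set-deck of $f$ is the set $\{f_I/{\equiv}\}$ of these classes. A function $f' \colon A^n \to B$ is a reconstruction (resp. set-reconstruction) of $f$ if $f$ and $f'$ have the same deck (resp. the same set-deck). A function is reconstructible (resp. set-reconstructible) if it is equivalent to all of its reconstructions (resp. set-reconstructions). -}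

module Defs where

open import Data.Nat using (ℕ; suc; _≤_)
open import Data.Fin using (Fin; _<_; _≟_; punchOut)
open import Data.Fin.Properties using (<⇒≢)
open import Data.Product using (Σ; ∃; _×_; _,_)
open import Function using (_∘_; _↔_)
open import Relation.Nullary using (yes; no)
open import Relation.Binary.PropositionalEquality using (_≡_; sym)

FiniteAtLeast2 : Set → Set
FiniteAtLeast2 A = Σ ℕ λ k → (2 ≤ k) × (Fin k ↔ A)

Fun : ℕ → Set → Set → Set
Fun n A B = (Fin n → A) → B

_isMinorOf_ : ∀ {A B : Set} {n m : ℕ} → Fun n A B → Fun m A B → Set
_isMinorOf_ {A} {B} {n} {m} f g =
  Σ (Fin m → Fin n) λ σ → ∀ (a : Fin n → A) → f a ≡ g (a ∘ σ)

_≣_ : ∀ {A B : Set} {n m : ℕ} → Fun n A B → Fun m A B → Set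
f ≣ g = (f isMinorOf g) × (g isMinorOf f)

-- 2-element subsets {i,j} of {0..n}, i < j  (arity n+1)
Pair : ℕ → Set
Pair m = Σ (Fin (suc m) × Fin (suc m)) λ { (i , j) → i < j }

-- index map for the identification minor: position k of the
-- (m+1)-tuple (a_1..a_{j-1}, a_i, a_j, .., a_m) reads coordinate idMap k of a
idMap : ∀ {m} (i j : Fin (suc m)) → i < j → Fin (suc m) → Fin m
idMap i j i<j k with k ≟ j
... | yes _   = punchOut {i = j} {j = i} (λ e → <⇒≢ i<j (sym e))
... | no  k≢j = punchOut {i = j} {j = k} (λ e → k≢j (sym e))

idMinor : ∀ {A B : Set} {m} → Fun (suc m) A B → Pair m → Fun m A B
idMinor f ((i , j) , i<j) a = f (a ∘ idMap i j i<j)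

-- same deck: the multisets of ≡-classes of identification minors agree,
-- i.e. a bijection of the 2-subsets matching classes
SameDeck : ∀ {A B : Set} {m} → Fun (suc m) A B → Fun (suc m) A B → Set
SameDeck {m = m} f g =
  Σ (Pair m ↔ Pair m) λ π → ∀ I → idMinor f I ≣ idMinor g (Function.Inverse.to π I)

SameSetDeck : ∀ {A B : Set} {m} → Fun (suc m) A B → Fun (suc m) A B → Set
SameSetDeck {m = m} f g =
  (∀ I → ∃ λ J → idMinor f I ≣ idMinor g J) ×
  (∀ J → ∃ λ I → idMinor g J ≣ idMinor f I)

Reconstructible : ∀ {A B : Set} {m} → Fun (suc m) A B → Set
Reconstructible {A} {B} {m} f = ∀ (g : Fun (suc m) A B) → SameDeck f g → f ≣ g

SetReconstructible : ∀ {A B : Set} {m} → Fun (suc m) A B → Set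
SetReconstructible {A} {B} {m} f = ∀ (g : Fun (suc m) A B) → SameSetDeck f g → f ≣ g

UniqueIdMinor : ∀ {A B : Set} {m} → Fun (suc m) A B → Set
UniqueIdMinor {m = m} f = ∀ (I J : Pair m) → idMinor f I ≣ idMinor f J

-- Equivalence of functions (each a minor of the other) is an
-- equivalence relation, since minors compose.  Having the same deck always
-- implies having the same set-deck: the bijection of 2-subsets matching the
-- minors provides the witnesses in both directions.  Conversely, if all
-- identification minors of f are equivalent, then a set-reconstruction g of f
-- already has the same deck as f, witnessed by the identity bijection: each
-- g_I is equivalent to some f_J, hence to f_I.  So for such f the
-- reconstructions and the set-reconstructions are the same functions, and
-- the two reconstructibility notions coincide.
module Submission where

open import Defs
open import Data.Nat using (ℕ; suc; _≤_)
open import Data.Product using (_,_)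
open import Function using (_⇔_; mk⇔; _∘_)
open import Function.Bundles using (Inverse)
open import Function.Construct.Identity using (↔-id)
open import Relation.Binary.PropositionalEquality using (trans; subst)

minor-trans : ∀ {A B : Set} {n m k} {f : Fun n A B} {g : Fun m A B} {h : Fun k A B} →
  f isMinorOf g → g isMinorOf h → f isMinorOf h
minor-trans (σ , f≗g∘σ) (τ , g≗h∘τ) = σ ∘ τ , λ a → trans (f≗g∘σ a) (g≗h∘τ (a ∘ σ))

≣-sym : ∀ {A B : Set} {n m} {f : Fun n A B} {g : Fun m A B} → f ≣ g → g ≣ f
≣-sym (f≤g , g≤f) = g≤f , f≤g

≣-trans : ∀ {A B : Set} {n m k} {f : Fun n A B} {g : Fun m A B} {h : Fun k A B} →
  f ≣ g → g ≣ h → f ≣ h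
≣-trans {f = f} {g} {h} (f≤g , g≤f) (g≤h , h≤g) =
  minor-trans {f = f} {g} {h} f≤g g≤h , minor-trans {f = h} {g} {f} h≤g g≤f

sameDeck⇒sameSetDeck : ∀ {A B : Set} {m} (f g : Fun (suc m) A B) →
  SameDeck f g → SameSetDeck f g
sameDeck⇒sameSetDeck f g (π , f≣g∘π) =
  (λ I → to I , f≣g∘π I) ,
  (λ J → from J , ≣-sym (g-matched J))
  where
  open Inverse π using (to; from; strictlyInverseˡ)
  g-matched : ∀ J → idMinor f (from J) ≣ idMinor g J
  g-matched J = subst (λ K → idMinor f (from J) ≣ idMinor g K)
                      (strictlyInverseˡ J) (f≣g∘π (from J))

uniqueIdMinor⇒sameDeck : ∀ {A B : Set} {m} (f g : Fun (suc m) A B) →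
  UniqueIdMinor f → SameSetDeck f g → SameDeck f g
uniqueIdMinor⇒sameDeck f g unique (_ , g-covered) = ↔-id _ , f≣g
  where
  f≣g : ∀ I → idMinor f I ≣ idMinor g I
  f≣g I with g-covered I
  ... | J , gI≣fJ = ≣-sym (≣-trans gI≣fJ (unique J I))

lemma2p5 : (A B : Set) → FiniteAtLeast2 A → FiniteAtLeast2 B →
    (m : ℕ) → 1 ≤ m → (f : Fun (suc m) A B) → UniqueIdMinor f →
    Reconstructible f ⇔ SetReconstructible f
lemma2p5 A B _ _ m _ f unique = mk⇔
  (λ reconstructible g sameSetDeck →
     reconstructible g (uniqueIdMinor⇒sameDeck f g unique sameSetDeck))
  (λ setReconstructible g sameDeck →
     setReconstructible g (sameDeck⇒sameSetDeck f g sameDeck))
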